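{- Let a $d$-dimensional polystochastic matrix $A$ of order $4$ be a convex sum of matrices $B$ and $B'$ equivalent to $\mathcal{M}_4^d$. If the tessellation index of $A$ is equal to $-\infty$ (i.e., no filled subcube of $B$ intersects a filled subcube of $B'$), then the permanent of $A$ is positive.
   Context: A $d$-dimensional matrix of order $4$ is indexed by $\alpha=(\alpha_1,\ldots,\alpha_d)\in\{0,1,2,3\}^d$. It is polystochastic if it is nonnegative and the sum of entries over each line (all coordinates but one fixed) equals $1$. The permanent is the sum over all diagonals (sets of $4$ indices pairwise distinct in every coordinate) of the products of the entries. $\mathcal{M}_4^d$ is the $d$-dimensional $(0,1)$-matrix of order $4$ with $m_\alpha=1$ iff $\alpha_1+\cdots+\alpha_d\equiv 0 \pmod 4$. Two matrices are equivalent if one is obtained from the other by permuting coordinate positions and permuting parallel hyperplanes of a direction. A convex sum of $B$ and $B'$ means $\lambda B+(1-\lambda)B'$ with $0<\lambda<1$. Subcubes and filled subcubes: let $\mathcal{P}_1=01|23$, $\mathcal{P}_2=02|13$, $\mathcal{P}_3=03|12$ be the three partitions of $\{0,1,2,3\}$ into pairs, and $p_i(a)\in\{0,1\}$ the part of $\mathcal{P}_i$ containing $a$ (with $p_i(0)=0$). A tuple $\mathcal{E}=(\varepsilon_1,\ldots,\varepsilon_d)\in\{1,2,3\}^d$ partitions the index set into $2^d$ subcubes $C_y$, $y\in\{0,1\}^d$, of order $2$, where $C_y=\{\alpha: p_{\varepsilon_i}(\alpha_i)=y_i \text{ for all } i\}$. Every matrix equivalent to $\mathcal{M}_4^d$ is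 a block permutation with uniquely determined parameters $(\mathcal{E},\lambda,s)$, $s\in\{0,1\}$: the subcubes $C_y$ with weight of $y$ congruent to $s$ mod $2$ each contain a $d$-dimensional permutation matrix of order $2$ (these are called filled subcubes, with the choice of the permutation given by a Boolean function $\lambda$), and all other subcubes are zero. The tessellation index of a convex sum $A$ of $B$ and $B'$ equivalent to $\mathcal{M}_4^d$ is the dimension of the maximal intersection of a filled subcube of $B$ with a filled subcube of $B'$, and it is $-\infty$ if no filled subcubes of $B$ and $B'$ intersect.
   Formalization: The convex coefficient λ and the entries of A are rational. -}

module Defs where

open import Data.Nat as ℕ using (ℕ; zero; suc; _%_)
open import Data.Fin as Fin using (Fin; zero; suc; toℕ)
open import Data.Fin.Permutation using (Permutation′; _⟨$⟩ʳ_)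
open import Data.Vec as Vec using (Vec; []; _∷_; lookup; tabulate; _[_]≔_)
open import Data.List as List using (List; concatMap; map; foldr; [_])
open import Data.Bool using (Bool; true; false; _∧_; not; if_then_else_)
open import Data.Integer using (+_)
open import Data.Rational using (ℚ; 0ℚ; 1ℚ; _+_; _*_; _≤_; _/_)
open import Data.Product using (Σ; _×_; ∃)
open import Data.Sum using (_⊎_)
open import Relation.Nullary using (¬_; does)
open import Relation.Binary.PropositionalEquality using (_≡_)

Index : ℕ → Set
Index d = Vec (Fin 4) d

Matrix : ℕ → Set
Matrix d = Index d → ℚ

allIdx : (d : ℕ) → List (Index d)
allIdx zero    = [ [] ]
allIdx (suc d) = concatMap (λ a → map (a ∷_) (allIdx d)) (List.allFin 4)

sumℚ : List ℚ → ℚ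
sumℚ = foldr _+_ 0ℚ

Polystochastic : {d : ℕ} → Matrix d → Set
Polystochastic {d} A =
  (∀ α → 0ℚ ≤ A α) ×
  (∀ (i : Fin d) (α : Index d) →
     sumℚ (map (λ a → A (α [ i ]≔ a)) (List.allFin 4)) ≡ 1ℚ)

_≠ᵇ_ : Fin 4 → Fin 4 → Bool
a ≠ᵇ b = not (does (a Fin.≟ b))

distinct4 : Fin 4 → Fin 4 → Fin 4 → Fin 4 → Bool
distinct4 a b c e =
  (a ≠ᵇ b) ∧ (a ≠ᵇ c) ∧ (a ≠ᵇ e) ∧ (b ≠ᵇ c) ∧ (b ≠ᵇ e) ∧ (c ≠ᵇ e)

isDiagonal : {d : ℕ} → Index d → Index d → Index d → Index d → Bool
isDiagonal []       []       []       []       = true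
isDiagonal (a ∷ as) (b ∷ bs) (c ∷ cs) (e ∷ es) =
  distinct4 a b c e ∧ isDiagonal as bs cs es

-- Permanent: sum over diagonals (4-element SETS of indices) of products.
-- We sum over ordered 4-tuples; for d ≥ 1 each diagonal (set) occurs
-- exactly 4! = 24 times, hence the factor 1/24.
permanent : {d : ℕ} → Matrix d → ℚ
permanent {d} A =
  ((+ 1) / 24) *
  sumℚ (concatMap (λ α → concatMap (λ β → concatMap (λ γ → map (λ δ →
          if isDiagonal α β γ δ then A α * A β * A γ * A δ else 0ℚ)
        (allIdx d)) (allIdx d)) (allIdx d)) (allIdx d))

sumIdx : {d : ℕ} → Index d → ℕ
sumIdx []       = 0
sumIdx (a ∷ as) = toℕ a ℕ.+ sumIdx as

M4 : (d : ℕ) → Matrix d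
M4 d α with sumIdx α % 4
... | zero  = 1ℚ
... | suc _ = 0ℚ

-- B is equivalent to M_4^d: obtained by permuting coordinate positions (σ)
-- and permuting parallel hyperplanes in each direction (π i)
EquivalentToM4 : {d : ℕ} → Matrix d → Set
EquivalentToM4 {d} B =
  Σ (Permutation′ d) λ σ → Σ (Fin d → Permutation′ 4) λ π →
    ∀ (α : Index d) →
      B α ≡ M4 d (tabulate λ i → π i ⟨$⟩ʳ lookup α (σ ⟨$⟩ʳ i))

data Partition : Set where
  P₁ P₂ P₃ : Partition   -- 01|23 , 02|13 , 03|12

-- p_i(a) : the part of P_i containing a, with p_i(0) = 0
part : Partition → Fin 4 → Fin 2
part P₁ zero                = zero
part P₁ (suc zero)          = zero
part P₁ (suc (suc zero))    = suc zero
part P₁ (suc (suc (suc _))) = suc zero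
part P₂ zero                = zero
part P₂ (suc zero)          = suc zero
part P₂ (suc (suc zero))    = zero
part P₂ (suc (suc (suc _))) = suc zero
part P₃ zero                = zero
part P₃ (suc zero)          = suc zero
part P₃ (suc (suc zero))    = suc zero
part P₃ (suc (suc (suc _))) = zero

partner : Partition → Fin 4 → Fin 4
partner P₁ zero                = suc zero
partner P₁ (suc zero)          = zero
partner P₁ (suc (suc zero))    = suc (suc (suc zero))
partner P₁ (suc (suc (suc _))) = suc (suc zero)
partner P₂ zero                = suc (suc zero)
partner P₂ (suc zero)          = suc (suc (suc zero))
partner P₂ (suc (suc zero))    = zero
partner P₂ (suc (suc (suc _))) = suc zero
partner P₃ zero                = suc (suc (suc zero))
partner P₃ (suc zero)          = suc (suc zero)
partner P₃ (suc (suc zero))    = suc zero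
partner P₃ (suc (suc (suc _))) = zero

-- the label y ∈ {0,1}^d of the subcube C_y (w.r.t. ℰ) containing α
cubeOf : {d : ℕ} → Vec Partition d → Index d → Vec (Fin 2) d
cubeOf []       []       = []
cubeOf (e ∷ es) (a ∷ as) = part e a ∷ cubeOf es as

InSubcube : {d : ℕ} → Vec Partition d → Vec (Fin 2) d → Index d → Set
InSubcube ℰ y α = cubeOf ℰ α ≡ y

weight : {d : ℕ} → Vec (Fin 2) d → ℕ
weight []       = 0
weight (b ∷ bs) = toℕ b ℕ.+ weight bs

Filled : {d : ℕ} → Fin 2 → Vec (Fin 2) d → Set
Filled s y = weight y % 2 ≡ toℕ s

-- B is a block permutation with parameters (ℰ, s): every filled subcube C_y
-- contains a d-dimensional permutation matrix of order 2 (B restricted to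
-- C_y is a (0,1)-matrix with exactly one 1 on each line of C_y), and all
-- other subcubes are zero.
IsBlockPermutation : {d : ℕ} → Matrix d → Vec Partition d → Fin 2 → Set
IsBlockPermutation {d} B ℰ s =
  ∀ (α : Index d) →
    (Filled s (cubeOf ℰ α) →
       (B α ≡ 0ℚ ⊎ B α ≡ 1ℚ) ×
       (∀ (i : Fin d) →
          B α + B (α [ i ]≔ partner (lookup ℰ i) (lookup α i)) ≡ 1ℚ)) ×
    (¬ Filled s (cubeOf ℰ α) → B α ≡ 0ℚ)

TessellationIndexMinusInfinity :
  {d : ℕ} → Vec Partition d → Fin 2 → Vec Partition d → Fin 2 → Set
TessellationIndexMinusInfinity {d} ℰ s ℰ' s' =
  ∀ (y y' : Vec (Fin 2) d) → Filled s y → Filled s' y' →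
    ¬ (∃ λ α → InSubcube ℰ y α × InSubcube ℰ' y' α)

-- Since no filled subcube of B meets a filled subcube of B′, both block structures use the same
-- pairings ℰ, and every subcube is filled for exactly one of B and B′. Hence the support S of A
-- (the indices where B or B′ equals 1) switches membership whenever one coordinate of an index is
-- replaced by its partner. Writing each coordinate as (part, position within the pair), membership
-- in S is its value at the base point of the subcube xor the parity of the positions.
-- A diagonal inside S is then built explicitly. For d = 2 take a point of S in the subcube with
-- parts (0,0) and the point obtained by moving both its coordinates to their partners, which stays
-- in S, and likewise in the subcube (1,1). For d ≥ 3 consider the quadruples of subcubes
-- {000,100,011,111}, {000,010,101,111} and {100,010,101,011}, the remaining coordinates copying the
-- third: each of the six subcubes lies in two of them, so some quadruple has an even sum of base
-- values, and on it the positions can be chosen so that all four points lie in S.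
-- A diagonal of positive entries makes the permanent of the nonnegative matrix A positive.
module Submission where

open import Data.Nat using (ℕ; _≤_)
open import Data.Fin using (Fin)
open import Data.Vec using (Vec)
open import Data.Rational using (ℚ; 0ℚ; 1ℚ; _+_; _*_; _-_; _<_)
open import Relation.Binary.PropositionalEquality using (_≡_)
open import Defs

open import Data.Bool using (Bool; true; false; not; _∧_; _∨_; _xor_; if_then_else_)
open import Data.Bool.Properties
  using (not-¬; ¬-not; xor-inverseˡ; xor-same; ∧-zeroʳ; ∨-identityʳ; not-distribˡ-xor; not-distribʳ-xor)
open import Data.Bool.Solver using (module xor-∧-Solver)
open import Data.Empty using (⊥-elim)
open import Data.Fin as Fin using (zero; suc; toℕ)
open import Data.List using (List; concatMap; map)
open import Data.List.Relation.Unary.All using (All; []; _∷_; universal)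
import Data.List.Relation.Unary.All.Properties as All
open import Data.List.Relation.Unary.Any using (Any; here; there)
open import Data.List.Membership.Propositional using (_∈_; lose)
open import Data.List.Membership.Propositional.Properties using (∈-concatMap⁺; ∈-map⁺; ∈-allFin)
open import Data.Nat as ℕ using (zero; suc; s≤s; z≤n; _%_)
open import Data.Nat.DivMod using (%-distribˡ-+)
open import Data.Product using (_×_; _,_; proj₁; proj₂; ∃)
open import Data.Rational using (-_; nonNegative; positive) renaming (_≤_ to _≤ℚ_)
import Data.Rational.Properties as ℚ
open import Data.Sum using (_⊎_; inj₁; inj₂)
open import Data.Vec as Vec using ([]; _∷_; replicate; lookup; _[_]≔_; tabulate; foldr′)
open import Data.Vec.Properties using (tabulate∘lookup; tabulate-cong)
open import Function using (_∘_)
open import Relation.Binary.Definitions using (DecidableEquality)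
open import Relation.Binary.PropositionalEquality
  using (_≢_; refl; sym; trans; cong; cong₂; subst; ≢-sym; module ≡-Reasoning)
open import Relation.Nullary using (¬_; Dec; yes; no; does; contradiction)
open import Relation.Nullary.Decidable using (dec-false)

private
  variable
    n : ℕ

base : Partition → Bool → Fin 4
base _  false = zero
base P₁ true  = suc (suc zero)
base P₂ true  = suc zero
base P₃ true  = suc zero

-- Coordinates on Fin 4 adapted to the pairing e: the part y, and the position b in the pair
-- relative to base e y.
pairElem : Partition → Bool → Bool → Fin 4
pairElem e y false = base e y
pairElem e y true  = partner e (base e y)

toBool : Fin 2 → Bool
toBool zero    = false
toBool (suc _) = true

pairCoords : Partition → Fin 4 → Bool × Bool
pairCoords e a = y , not (does (a Fin.≟ base e y))
  where y = toBool (part e a)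

pairCoords-pairElem : ∀ e y b → pairCoords e (pairElem e y b) ≡ (y , b)
pairCoords-pairElem P₁ false false = refl
pairCoords-pairElem P₁ false true  = refl
pairCoords-pairElem P₁ true  false = refl
pairCoords-pairElem P₁ true  true  = refl
pairCoords-pairElem P₂ false false = refl
pairCoords-pairElem P₂ false true  = refl
pairCoords-pairElem P₂ true  false = refl
pairCoords-pairElem P₂ true  true  = refl
pairCoords-pairElem P₃ false false = refl
pairCoords-pairElem P₃ false true  = refl
pairCoords-pairElem P₃ true  false = refl
pairCoords-pairElem P₃ true  true  = refl

pairElem-injective : ∀ e {y b y′ b′} → pairElem e y b ≡ pairElem e y′ b′ → (y , b) ≡ (y′ , b′)
pairElem-injective e {y} {b} {y′} {b′} eq =
  trans (sym (pairCoords-pairElem e y b)) (trans (cong (pairCoords e) eq) (pairCoords-pairElem e y′ b′))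

partner-pairElem : ∀ e y b → partner e (pairElem e y b) ≡ pairElem e y (not b)
partner-pairElem _  _     false = refl
partner-pairElem P₁ false true  = refl
partner-pairElem P₁ true  true  = refl
partner-pairElem P₂ false true  = refl
partner-pairElem P₂ true  true  = refl
partner-pairElem P₃ false true  = refl
partner-pairElem P₃ true  true  = refl

pairElem-≢-part : ∀ e y b c → pairElem e y b ≢ pairElem e (not y) c
pairElem-≢-part e y b c = not-¬ refl ∘ cong proj₁ ∘ pairElem-injective e {y} {b} {not y} {c}

pairElem-≢-bit : ∀ e y b → pairElem e y b ≢ pairElem e y (not b)
pairElem-≢-bit e y b = not-¬ refl ∘ cong proj₂ ∘ pairElem-injective e {y} {b} {y} {not b}

∧-true : ∀ {x y} → x ≡ true → y ≡ true → x ∧ y ≡ true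
∧-true refl refl = refl

≠ᵇ-true : ∀ {a b} → a ≢ b → a ≠ᵇ b ≡ true
≠ᵇ-true {a} {b} a≢b = cong not (dec-false (a Fin.≟ b) a≢b)

distinct4-intro : ∀ {a b c e} →
  a ≢ b → a ≢ c → a ≢ e → b ≢ c → b ≢ e → c ≢ e → distinct4 a b c e ≡ true
distinct4-intro ab ac ae bc be ce =
  ∧-true (≠ᵇ-true ab) (∧-true (≠ᵇ-true ac) (∧-true (≠ᵇ-true ae)
    (∧-true (≠ᵇ-true bc) (∧-true (≠ᵇ-true be) (≠ᵇ-true ce)))))

column-aabb : ∀ e y b c →
  distinct4 (pairElem e y b) (pairElem e y (not b)) (pairElem e (not y) c) (pairElem e (not y) (not c)) ≡ true
column-aabb e y b c = distinct4-intro
  (pairElem-≢-bit e y b) (pairElem-≢-part e y b c) (pairElem-≢-part e y b (not c))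
  (pairElem-≢-part e y (not b) c) (pairElem-≢-part e y (not b) (not c)) (pairElem-≢-bit e (not y) c)

column-abab : ∀ e y b c →
  distinct4 (pairElem e y b) (pairElem e (not y) c) (pairElem e y (not b)) (pairElem e (not y) (not c)) ≡ true
column-abab e y b c = distinct4-intro
  (pairElem-≢-part e y b c) (pairElem-≢-bit e y b) (pairElem-≢-part e y b (not c))
  (≢-sym (pairElem-≢-part e y (not b) c)) (pairElem-≢-bit e (not y) c) (pairElem-≢-part e y (not b) (not c))

partnerAt : Vec Partition n → Fin n → Index n → Index n
partnerAt ℰ i α = α [ i ]≔ partner (lookup ℰ i) (lookup α i)

Toggles : Vec Partition n → (Index n → Bool) → Set
Toggles ℰ S = ∀ α i → S (partnerAt ℰ i α) ≡ not (S α)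

record DiagonalIn {d : ℕ} (P : Index d → Set) : Set where
  field
    p₁ p₂ p₃ p₄ : Index d
    diagonal : isDiagonal p₁ p₂ p₃ p₄ ≡ true
    P-p₁ : P p₁
    P-p₂ : P p₂
    P-p₃ : P p₃
    P-p₄ : P p₄

mapDiagonalIn : ∀ {d} {P Q : Index d → Set} → (∀ α → P α → Q α) → DiagonalIn P → DiagonalIn Q
mapDiagonalIn P⇒Q D = record
  { p₁ = p₁ ; p₂ = p₂ ; p₃ = p₃ ; p₄ = p₄ ; diagonal = diagonal
  ; P-p₁ = P⇒Q p₁ P-p₁ ; P-p₂ = P⇒Q p₂ P-p₂ ; P-p₃ = P⇒Q p₃ P-p₃ ; P-p₄ = P⇒Q p₄ P-p₄ }
  where open DiagonalIn D

pairIndex : Vec Partition n → Vec Bool n → Vec Bool n → Index n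
pairIndex []      []       []       = []
pairIndex (e ∷ ℰ) (y ∷ ys) (b ∷ bs) = pairElem e y b ∷ pairIndex ℰ ys bs

corners-diagonal : (ℰ : Vec Partition n) →
  isDiagonal (pairIndex ℰ (replicate n false) (replicate n false))
             (pairIndex ℰ (replicate n false) (replicate n true))
             (pairIndex ℰ (replicate n true) (replicate n false))
             (pairIndex ℰ (replicate n true) (replicate n true)) ≡ true
corners-diagonal []      = refl
corners-diagonal (e ∷ ℰ) = ∧-true (column-aabb e false false false) (corners-diagonal ℰ)

module _ {e : Partition} {ℰ : Vec Partition n} {S : Index (suc n) → Bool} (toggles : Toggles (e ∷ ℰ) S) where

  toggles-tail : ∀ a → Toggles ℰ (S ∘ (a ∷_))
  toggles-tail a α i = toggles (a ∷ α) (suc i)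

  toggles-head : ∀ y b α → S (pairElem e y b ∷ α) ≡ b xor S (pairElem e y false ∷ α)
  toggles-head y false α = refl
  toggles-head y true  α = toggles (pairElem e y false ∷ α) zero

toggles-pairIndex : ∀ {ℰ : Vec Partition n} {S} → Toggles ℰ S → ∀ ys bs →
  S (pairIndex ℰ ys bs) ≡ foldr′ _xor_ (S (pairIndex ℰ ys (replicate n false))) bs
toggles-pairIndex {ℰ = []}    toggles []       []       = refl
toggles-pairIndex {ℰ = e ∷ ℰ} {S} toggles (y ∷ ys) (b ∷ bs) = begin
  S (pairElem e y b ∷ pairIndex ℰ ys bs)
    ≡⟨ toggles-head toggles y b _ ⟩
  b xor S (pairElem e y false ∷ pairIndex ℰ ys bs)
    ≡⟨ cong (b xor_) (toggles-pairIndex (toggles-tail toggles (pairElem e y false)) ys bs) ⟩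
  b xor foldr′ _xor_ (S (pairElem e y false ∷ pairIndex ℰ ys (replicate _ false))) bs ∎
  where open ≡-Reasoning

foldr-xor-replicate : ∀ n q x →
  foldr′ _xor_ x (replicate n q) ≡ (q ∧ foldr′ _xor_ false (replicate n true)) xor x
foldr-xor-replicate zero    q     x = cong (_xor x) (sym (∧-zeroʳ q))
foldr-xor-replicate (suc n) false x = foldr-xor-replicate n false x
foldr-xor-replicate (suc n) true  x =
  trans (cong not (foldr-xor-replicate n true x))
        (not-distribˡ-xor (foldr′ _xor_ false (replicate n true)) x)

square-diagonal : ∀ e₀ e₁ {S} → Toggles (e₀ ∷ e₁ ∷ []) S → DiagonalIn (λ α → S α ≡ true)
square-diagonal e₀ e₁ {S} toggles = record
  { p₁ = point false f₁ false false
  ; p₂ = point false (not f₁) false true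
  ; p₃ = point true f₃ true false
  ; p₄ = point true (not f₃) true true
  ; diagonal = ∧-true (column-aabb e₀ false f₁ f₃) (∧-true (column-aabb e₁ false false false) refl)
  ; P-p₁ = trans (S-point false f₁ false false) (xor-inverseˡ (r false))
  ; P-p₂ = trans (S-point false (not f₁) false true) (xor-inverseˡ f₁)
  ; P-p₃ = trans (S-point true f₃ true false) (xor-inverseˡ (r true))
  ; P-p₄ = trans (S-point true (not f₃) true true) (xor-inverseˡ f₃)
  }
  where
  point : Bool → Bool → Bool → Bool → Index 2
  point y₀ b₀ y₁ b₁ = pairIndex (e₀ ∷ e₁ ∷ []) (y₀ ∷ y₁ ∷ []) (b₀ ∷ b₁ ∷ [])

  r : Bool → Bool
  r y = S (point y false y false)

  S-point : ∀ y₀ b₀ y₁ b₁ → S (point y₀ b₀ y₁ b₁) ≡ b₀ xor (b₁ xor S (point y₀ false y₁ false))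
  S-point y₀ b₀ y₁ b₁ = toggles-pairIndex toggles (y₀ ∷ y₁ ∷ []) (b₀ ∷ b₁ ∷ [])

  f₁ f₃ : Bool
  f₁ = not (r false)
  f₃ = not (r true)

module CubeCase {n : ℕ} (e₀ e₁ e₂ : Partition) (ℰ : Vec Partition n) {S : Index (3 ℕ.+ n) → Bool}
                (toggles : Toggles (e₀ ∷ e₁ ∷ e₂ ∷ ℰ) S) where

  open xor-∧-Solver using (solve; Polynomial; _:+_; _:=_; con)

  :¬_ : ∀ {k} → Polynomial k → Polynomial k
  :¬ p = con true :+ p

  point : (y₀ b₀ y₁ b₁ y₂ b₂ q : Bool) → Index (3 ℕ.+ n)
  point y₀ b₀ y₁ b₁ y₂ b₂ q =
    pairIndex (e₀ ∷ e₁ ∷ e₂ ∷ ℰ) (y₀ ∷ y₁ ∷ y₂ ∷ replicate n y₂) (b₀ ∷ b₁ ∷ b₂ ∷ replicate n q)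

  r : Bool → Bool → Bool → Bool
  r y₀ y₁ y₂ = S (point y₀ false y₁ false y₂ false false)

  r₀₀₀ r₁₀₀ r₀₁₀ r₁₀₁ r₀₁₁ r₁₁₁ : Bool
  r₀₀₀ = r false false false
  r₁₀₀ = r true false false
  r₀₁₀ = r false true false
  r₁₀₁ = r true false true
  r₀₁₁ = r false true true
  r₁₁₁ = r true true true

  w : Bool
  w = foldr′ _xor_ false (replicate n true)

  S-point : ∀ y₀ b₀ y₁ b₁ y₂ b₂ q →
    S (point y₀ b₀ y₁ b₁ y₂ b₂ q) ≡ b₀ xor (b₁ xor (b₂ xor ((q ∧ w) xor r y₀ y₁ y₂)))
  S-point y₀ b₀ y₁ b₁ y₂ b₂ q =
    trans (toggles-pairIndex toggles (y₀ ∷ y₁ ∷ y₂ ∷ replicate n y₂) (b₀ ∷ b₁ ∷ b₂ ∷ replicate n q))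
          (cong (λ t → b₀ xor (b₁ xor (b₂ xor t))) (foldr-xor-replicate n q (r y₀ y₁ y₂)))

  Σ₁ Σ₂ Σ₃ : Bool
  Σ₁ = r₀₀₀ xor (r₁₀₀ xor (r₀₁₁ xor r₁₁₁))
  Σ₂ = r₀₀₀ xor (r₀₁₀ xor (r₁₀₁ xor r₁₁₁))
  Σ₃ = r₁₀₀ xor (r₀₁₀ xor (r₁₀₁ xor r₀₁₁))

  Σ₃≡Σ₁xorΣ₂ : Σ₃ ≡ Σ₁ xor Σ₂
  Σ₃≡Σ₁xorΣ₂ =
    solve 6 (λ a b c d e f → b :+ (e :+ (f :+ c)) := (a :+ (b :+ (c :+ d))) :+ (a :+ (e :+ (f :+ d)))) refl
      r₀₀₀ r₁₀₀ r₀₁₁ r₁₁₁ r₀₁₀ r₁₀₁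

  -- On each plane, p₁, p₂ and p₃ have a free position fᵢ that puts them in S; the diagonal
  -- then determines p₄, which lies in S exactly when the sum over the plane is even.
  plane₁ : Σ₁ ≡ false → DiagonalIn (λ α → S α ≡ true)
  plane₁ even = record
    { p₁ = point false false false f₁ false false false
    ; p₂ = point true f₂ false (not f₁) false true true
    ; p₃ = point false true true f₃ true false false
    ; p₄ = point true (not f₂) true (not f₃) true true true
    ; diagonal = ∧-true (column-abab e₀ false false f₂) (∧-true (column-aabb e₁ false f₁ f₃)
                   (∧-true (column-aabb e₂ false false false) (corners-diagonal ℰ)))
    ; P-p₁ = trans (S-point false false false f₁ false false false) (xor-inverseˡ r₀₀₀)
    ; P-p₂ = trans (S-point true f₂ false (not f₁) false true true) (xor-inverseˡ rest₂)
    ; P-p₃ = trans (S-point false true true f₃ true false false) (cong not (xor-same f₃))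
    ; P-p₄ = trans (S-point true (not f₂) true (not f₃) true true true)
                   (trans (p₄-value r₀₀₀ r₁₀₀ r₀₁₁ r₁₁₁ w)
                          (cong not even))
    }
    where
    f₁ = not r₀₀₀
    rest₂ = not f₁ xor not (w xor r₁₀₀)
    f₂ = not rest₂
    f₃ = r₀₁₁
    p₄-value : ∀ a b c d w →
      not (not (not (not a) xor not (w xor b))) xor (not c xor not (w xor d)) ≡ not (a xor (b xor (c xor d)))
    p₄-value = solve 5 (λ a b c d w →
      :¬ (:¬ (:¬ (:¬ a) :+ :¬ (w :+ b))) :+ (:¬ c :+ :¬ (w :+ d)) := :¬ (a :+ (b :+ (c :+ d)))) refl

  plane₂ : Σ₂ ≡ false → DiagonalIn (λ α → S α ≡ true)
  plane₂ even = record
    { p₁ = point false false false f₁ false false false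
    ; p₂ = point false true true f₂ false true true
    ; p₃ = point true f₃ false (not f₁) true false false
    ; p₄ = point true (not f₃) true (not f₂) true true true
    ; diagonal = ∧-true (column-aabb e₀ false false f₃) (∧-true (column-abab e₁ false f₁ f₂)
                   (∧-true (column-aabb e₂ false false false) (corners-diagonal ℰ)))
    ; P-p₁ = trans (S-point false false false f₁ false false false) (xor-inverseˡ r₀₀₀)
    ; P-p₂ = trans (S-point false true true f₂ false true true) (cong not (xor-same f₂))
    ; P-p₃ = trans (S-point true f₃ false (not f₁) true false false) (xor-inverseˡ rest₃)
    ; P-p₄ = trans (S-point true (not f₃) true (not f₂) true true true)
                   (trans (p₄-value r₀₀₀ r₀₁₀ r₁₀₁ r₁₁₁ w)
                          (cong not even))
    }
    where
    f₁ = not r₀₀₀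
    f₂ = not (w xor r₀₁₀)
    rest₃ = not f₁ xor r₁₀₁
    f₃ = not rest₃
    p₄-value : ∀ a b c d w →
      not (not (not (not a) xor c)) xor (not (not (w xor b)) xor not (w xor d)) ≡ not (a xor (b xor (c xor d)))
    p₄-value = solve 5 (λ a b c d w →
      :¬ (:¬ (:¬ (:¬ a) :+ c)) :+ (:¬ (:¬ (w :+ b)) :+ :¬ (w :+ d)) := :¬ (a :+ (b :+ (c :+ d)))) refl

  plane₃ : Σ₃ ≡ false → DiagonalIn (λ α → S α ≡ true)
  plane₃ even = record
    { p₁ = point true false false false false f₁ false
    ; p₂ = point false f₂ true false false (not f₁) true
    ; p₃ = point true true false true true f₃ false
    ; p₄ = point false (not f₂) true true true (not f₃) true
    ; diagonal = ∧-true (column-abab e₀ true false f₂) (∧-true (column-abab e₁ false false false)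
                   (∧-true (column-aabb e₂ false f₁ f₃) (corners-diagonal ℰ)))
    ; P-p₁ = trans (S-point true false false false false f₁ false) (xor-inverseˡ r₁₀₀)
    ; P-p₂ = trans (S-point false f₂ true false false (not f₁) true) (xor-inverseˡ rest₂)
    ; P-p₃ = trans (S-point true true false true true f₃ false) (cong (not ∘ not) (xor-inverseˡ r₁₀₁))
    ; P-p₄ = trans (S-point false (not f₂) true true true (not f₃) true)
                   (trans (p₄-value r₁₀₀ r₀₁₀ r₁₀₁ r₀₁₁ w)
                          (cong not even))
    }
    where
    f₁ = not r₁₀₀
    rest₂ = not f₁ xor (w xor r₀₁₀)
    f₂ = not rest₂
    f₃ = not r₁₀₁
    p₄-value : ∀ a b c d w →
      not (not (not (not a) xor (w xor b))) xor not (not (not c) xor (w xor d)) ≡ not (a xor (b xor (c xor d)))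
    p₄-value = solve 5 (λ a b c d w →
      :¬ (:¬ (:¬ (:¬ a) :+ (w :+ b))) :+ :¬ (:¬ (:¬ c) :+ (w :+ d)) := :¬ (a :+ (b :+ (c :+ d)))) refl

  diagonal : DiagonalIn (λ α → S α ≡ true)
  diagonal with Σ₁ in eq₁ | Σ₂ in eq₂
  ... | false | _     = plane₁ eq₁
  ... | true  | false = plane₂ eq₂
  ... | true  | true  = plane₃ (trans Σ₃≡Σ₁xorΣ₂ (cong₂ _xor_ eq₁ eq₂))

toggles⇒diagonal : ∀ {m} (ℰ : Vec Partition (2 ℕ.+ m)) {S} → Toggles ℰ S → DiagonalIn (λ α → S α ≡ true)
toggles⇒diagonal {zero}  (e₀ ∷ e₁ ∷ [])     = square-diagonal e₀ e₁
toggles⇒diagonal {suc _} (e₀ ∷ e₁ ∷ e₂ ∷ ℰ) = CubeCase.diagonal e₀ e₁ e₂ ℰ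

_≟ₚ_ : DecidableEquality Partition
P₁ ≟ₚ P₁ = yes refl
P₁ ≟ₚ P₂ = no λ ()
P₁ ≟ₚ P₃ = no λ ()
P₂ ≟ₚ P₁ = no λ ()
P₂ ≟ₚ P₂ = yes refl
P₂ ≟ₚ P₃ = no λ ()
P₃ ≟ₚ P₁ = no λ ()
P₃ ≟ₚ P₂ = no λ ()
P₃ ≟ₚ P₃ = yes refl

part-partner : ∀ e a → part e (partner e a) ≡ part e a
part-partner P₁ zero                   = refl
part-partner P₁ (suc zero)             = refl
part-partner P₁ (suc (suc zero))       = refl
part-partner P₁ (suc (suc (suc zero))) = refl
part-partner P₂ zero                   = refl
part-partner P₂ (suc zero)             = refl
part-partner P₂ (suc (suc zero))       = refl
part-partner P₂ (suc (suc (suc zero))) = refl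
part-partner P₃ zero                   = refl
part-partner P₃ (suc zero)             = refl
part-partner P₃ (suc (suc zero))       = refl
part-partner P₃ (suc (suc (suc zero))) = refl

partner-crosses : ∀ e e′ a → e ≢ e′ → part e′ (partner e a) ≢ part e′ a
partner-crosses P₁ P₁ _ e≢e′ = contradiction refl e≢e′
partner-crosses P₂ P₂ _ e≢e′ = contradiction refl e≢e′
partner-crosses P₃ P₃ _ e≢e′ = contradiction refl e≢e′
partner-crosses P₁ P₂ zero                   _ = λ ()
partner-crosses P₁ P₂ (suc zero)             _ = λ ()
partner-crosses P₁ P₂ (suc (suc zero))       _ = λ ()
partner-crosses P₁ P₂ (suc (suc (suc zero))) _ = λ ()
partner-crosses P₁ P₃ zero                   _ = λ ()
partner-crosses P₁ P₃ (suc zero)             _ = λ ()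
partner-crosses P₁ P₃ (suc (suc zero))       _ = λ ()
partner-crosses P₁ P₃ (suc (suc (suc zero))) _ = λ ()
partner-crosses P₂ P₁ zero                   _ = λ ()
partner-crosses P₂ P₁ (suc zero)             _ = λ ()
partner-crosses P₂ P₁ (suc (suc zero))       _ = λ ()
partner-crosses P₂ P₁ (suc (suc (suc zero))) _ = λ ()
partner-crosses P₂ P₃ zero                   _ = λ ()
partner-crosses P₂ P₃ (suc zero)             _ = λ ()
partner-crosses P₂ P₃ (suc (suc zero))       _ = λ ()
partner-crosses P₂ P₃ (suc (suc (suc zero))) _ = λ ()
partner-crosses P₃ P₁ zero                   _ = λ ()
partner-crosses P₃ P₁ (suc zero)             _ = λ ()
partner-crosses P₃ P₁ (suc (suc zero))       _ = λ ()
partner-crosses P₃ P₁ (suc (suc (suc zero))) _ = λ ()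
partner-crosses P₃ P₂ zero                   _ = λ ()
partner-crosses P₃ P₂ (suc zero)             _ = λ ()
partner-crosses P₃ P₂ (suc (suc zero))       _ = λ ()
partner-crosses P₃ P₂ (suc (suc (suc zero))) _ = λ ()

another : Partition → Partition
another P₁ = P₂
another P₂ = P₃
another P₃ = P₁

another-≢ : ∀ e → another e ≢ e
another-≢ P₁ = λ ()
another-≢ P₂ = λ ()
another-≢ P₃ = λ ()

parity : Vec (Fin 2) n → Bool
parity []      = false
parity (b ∷ y) = toBool b xor parity y

weight%2≡parity : (y : Vec (Fin 2) n) → weight y % 2 ≡ (if parity y then 1 else 0)
weight%2≡parity []             = refl
weight%2≡parity (zero ∷ y)     = weight%2≡parity y
weight%2≡parity (suc zero ∷ y) = begin
  suc (weight y) % 2                     ≡⟨ %-distribˡ-+ 1 (weight y) 2 ⟩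
  suc (weight y % 2) % 2                 ≡⟨ cong (λ k → suc k % 2) (weight%2≡parity y) ⟩
  suc (if parity y then 1 else 0) % 2    ≡⟨ suc-bit (parity y) ⟩
  (if not (parity y) then 1 else 0)      ∎
  where
  open ≡-Reasoning
  suc-bit : ∀ p → suc (if p then 1 else 0) % 2 ≡ (if not p then 1 else 0)
  suc-bit false = refl
  suc-bit true  = refl

filled? : ∀ s (y : Vec (Fin 2) n) → Dec (Filled s y)
filled? s y = weight y % 2 ℕ.≟ toℕ s

parity⇒Filled : ∀ {s} (y : Vec (Fin 2) n) → parity y ≡ toBool s → Filled s y
parity⇒Filled {s = s} y eq =
  trans (weight%2≡parity y) (subst (λ p → (if p then 1 else 0) ≡ toℕ s) (sym eq) (bit s))
  where
  bit : ∀ (s : Fin 2) → (if toBool s then 1 else 0) ≡ toℕ s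
  bit zero       = refl
  bit (suc zero) = refl

Filled-opposite-parity : ∀ {s} (y y′ : Vec (Fin 2) n) → ¬ Filled s y → parity y′ ≡ not (parity y) → Filled s y′
Filled-opposite-parity y y′ ¬filled eq =
  parity⇒Filled y′ (trans eq (sym (¬-not (¬filled ∘ parity⇒Filled y ∘ sym))))

toBool-≢ : ∀ {x y : Fin 2} → x ≢ y → toBool x ≡ not (toBool y)
toBool-≢ {zero}     {zero}     x≢y = contradiction refl x≢y
toBool-≢ {zero}     {suc zero} _   = refl
toBool-≢ {suc zero} {zero}     _   = refl
toBool-≢ {suc zero} {suc zero} x≢y = contradiction refl x≢y

cubeOf-within-part : ∀ (ℰ : Vec Partition n) α i c →
  part (lookup ℰ i) c ≡ part (lookup ℰ i) (lookup α i) → cubeOf ℰ (α [ i ]≔ c) ≡ cubeOf ℰ α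
cubeOf-within-part (e ∷ ℰ) (a ∷ α) zero    c eq = cong (_∷ cubeOf ℰ α) eq
cubeOf-within-part (e ∷ ℰ) (a ∷ α) (suc i) c eq = cong (part e a ∷_) (cubeOf-within-part ℰ α i c eq)

cubeOf-partnerAt : ∀ (ℰ : Vec Partition n) i α → cubeOf ℰ (partnerAt ℰ i α) ≡ cubeOf ℰ α
cubeOf-partnerAt ℰ i α = cubeOf-within-part ℰ α i _ (part-partner (lookup ℰ i) (lookup α i))

parity-across-part : ∀ (ℰ : Vec Partition n) α i c →
  part (lookup ℰ i) c ≢ part (lookup ℰ i) (lookup α i) →
  parity (cubeOf ℰ (α [ i ]≔ c)) ≡ not (parity (cubeOf ℰ α))
parity-across-part (e ∷ ℰ) (a ∷ α) zero c ne =
  trans (cong (_xor parity (cubeOf ℰ α)) (toBool-≢ ne)) (sym (not-distribˡ-xor (toBool (part e a)) _))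
parity-across-part (e ∷ ℰ) (a ∷ α) (suc i) c ne =
  trans (cong (toBool (part e a) xor_) (parity-across-part ℰ α i c ne))
        (sym (not-distribʳ-xor (toBool (part e a)) _))

Filled-move-across-part : ∀ {s} (ℰ : Vec Partition n) α i c → ¬ Filled s (cubeOf ℰ α) →
  part (lookup ℰ i) c ≢ part (lookup ℰ i) (lookup α i) → Filled s (cubeOf ℰ (α [ i ]≔ c))
Filled-move-across-part ℰ α i c ¬filled ne =
  Filled-opposite-parity (cubeOf ℰ α) (cubeOf ℰ (α [ i ]≔ c)) ¬filled (parity-across-part ℰ α i c ne)

move-into-filled : ∀ {ℰ ℰ′ : Vec Partition n} {s} i → lookup ℰ′ i ≢ lookup ℰ i → ∀ α →
  ∃ λ β → Filled s (cubeOf ℰ β) × cubeOf ℰ′ β ≡ cubeOf ℰ′ α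
move-into-filled {ℰ = ℰ} {ℰ′} {s} i e′≢e α with filled? s (cubeOf ℰ α)
... | yes filled = α , filled , refl
... | no ¬filled =
  partnerAt ℰ′ i α ,
  Filled-move-across-part ℰ α i _ ¬filled (partner-crosses (lookup ℰ′ i) (lookup ℰ i) (lookup α i) e′≢e) ,
  cubeOf-partnerAt ℰ′ i α

module _ {ℰ ℰ′ : Vec Partition n} {s s′} (tess : TessellationIndexMinusInfinity ℰ s ℰ′ s′) where

  filled-disjoint : ∀ α → Filled s (cubeOf ℰ α) → ¬ Filled s′ (cubeOf ℰ′ α)
  filled-disjoint α filled filled′ = tess _ _ filled filled′ (α , refl , refl)

  same-partitions : ℰ ≡ ℰ′
  same-partitions = begin
    ℰ                   ≡⟨ tabulate∘lookup ℰ ⟨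
    tabulate (lookup ℰ)  ≡⟨ tabulate-cong same-at ⟩
    tabulate (lookup ℰ′) ≡⟨ tabulate∘lookup ℰ′ ⟩
    ℰ′                  ∎
    where
    open ≡-Reasoning
    same-at : ∀ i → lookup ℰ i ≡ lookup ℰ′ i
    same-at i with lookup ℰ i ≟ₚ lookup ℰ′ i
    ... | yes e≡e′ = e≡e′
    ... | no  e≢e′ with move-into-filled {ℰ = ℰ} {ℰ′} {s} i (e≢e′ ∘ sym) (replicate _ zero)
    ...   | β , filled , _ with move-into-filled {ℰ = ℰ′} {ℰ} {s′} i e≢e′ β
    ...     | γ , filled′ , same-cube =
      contradiction filled′ (filled-disjoint γ (subst (Filled s) (sym same-cube) filled))

filled-or-filled′ : ∀ {ℰ : Vec Partition n} {s s′} → TessellationIndexMinusInfinity ℰ s ℰ s′ →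
  ∀ α (i : Fin n) → Filled s (cubeOf ℰ α) ⊎ Filled s′ (cubeOf ℰ α)
filled-or-filled′ {ℰ = ℰ} {s} {s′} tess α i with filled? s (cubeOf ℰ α) | filled? s′ (cubeOf ℰ α)
... | yes filled | _           = inj₁ filled
... | no _       | yes filled′ = inj₂ filled′
... | no ¬filled | no ¬filled′ = ⊥-elim (filled-disjoint tess β
  (Filled-move-across-part ℰ α i c ¬filled crosses) (Filled-move-across-part ℰ α i c ¬filled′ crosses))
  where
  c = partner (another (lookup ℰ i)) (lookup α i)
  β = α [ i ]≔ c
  crosses = partner-crosses (another (lookup ℰ i)) (lookup ℰ i) (lookup α i) (another-≢ (lookup ℰ i))

isOne : ℚ → Bool
isOne q = does (q ℚ.≟ 1ℚ)

isOne-complement : ∀ {x y} → x ≡ 0ℚ ⊎ x ≡ 1ℚ → y ≡ 0ℚ ⊎ y ≡ 1ℚ → x + y ≡ 1ℚ →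
  isOne y ≡ not (isOne x)
isOne-complement (inj₁ refl) (inj₁ refl) ()
isOne-complement (inj₁ refl) (inj₂ refl) _ = refl
isOne-complement (inj₂ refl) (inj₁ refl) _ = refl
isOne-complement (inj₂ refl) (inj₂ refl) ()

module _ {B : Matrix n} {ℰ s} (block : IsBlockPermutation B ℰ s) where

  entry-0-or-1 : ∀ α → B α ≡ 0ℚ ⊎ B α ≡ 1ℚ
  entry-0-or-1 α with filled? s (cubeOf ℰ α)
  ... | yes filled = proj₁ (proj₁ (block α) filled)
  ... | no ¬filled = inj₁ (proj₂ (block α) ¬filled)

  one⇒Filled : ∀ α → B α ≡ 1ℚ → Filled s (cubeOf ℰ α)
  one⇒Filled α B≡1 with filled? s (cubeOf ℰ α)
  ... | yes filled = filled
  ... | no ¬filled = contradiction (trans (sym B≡1) (proj₂ (block α) ¬filled)) λ ()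

  isOne-toggles : ∀ α i → Filled s (cubeOf ℰ α) → isOne (B (partnerAt ℰ i α)) ≡ not (isOne (B α))
  isOne-toggles α i filled =
    isOne-complement (entry-0-or-1 α) (entry-0-or-1 _) (proj₂ (proj₁ (block α) filled) i)

support : Matrix n → Matrix n → Index n → Bool
support B B′ α = isOne (B α) ∨ isOne (B′ α)

module _ {B B′ : Matrix n} {ℰ s s′}
         (block : IsBlockPermutation B ℰ s) (block′ : IsBlockPermutation B′ ℰ s′)
         (tess : TessellationIndexMinusInfinity ℰ s ℰ s′) where

  private
    vanishes : ∀ α → Filled s′ (cubeOf ℰ α) → B α ≡ 0ℚ
    vanishes α filled′ = proj₂ (block α) (λ filled → filled-disjoint tess α filled filled′)

    vanishes′ : ∀ α → Filled s (cubeOf ℰ α) → B′ α ≡ 0ℚ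
    vanishes′ α filled = proj₂ (block′ α) (filled-disjoint tess α filled)

    support≡B : ∀ {α} → B′ α ≡ 0ℚ → support B B′ α ≡ isOne (B α)
    support≡B {α} B′≡0 = trans (cong (λ q → isOne (B α) ∨ isOne q) B′≡0) (∨-identityʳ _)

    support≡B′ : ∀ {α} → B α ≡ 0ℚ → support B B′ α ≡ isOne (B′ α)
    support≡B′ {α} B≡0 = cong (λ q → isOne q ∨ isOne (B′ α)) B≡0

  support-toggles : Toggles ℰ (support B B′)
  support-toggles α i = toggle (filled-or-filled′ tess α i)
    where
    β = partnerAt ℰ i α
    same-cube = cubeOf-partnerAt ℰ i α

    toggle : Filled s (cubeOf ℰ α) ⊎ Filled s′ (cubeOf ℰ α) → support B B′ β ≡ not (support B B′ α)
    toggle (inj₁ filled) =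
        trans (support≡B (vanishes′ β (subst (Filled s) (sym same-cube) filled)))
            (trans (isOne-toggles {ℰ = ℰ} block α i filled)
                   (cong not (sym (support≡B (vanishes′ α filled)))))
    toggle (inj₂ filled′) =
      trans (support≡B′ (vanishes β (subst (Filled s′) (sym same-cube) filled′)))
            (trans (isOne-toggles {ℰ = ℰ} block′ α i filled′)
                   (cong not (sym (support≡B′ (vanishes α filled′)))))

  support⇒exactly-one : ∀ α → support B B′ α ≡ true →
    (B α ≡ 1ℚ × B′ α ≡ 0ℚ) ⊎ (B α ≡ 0ℚ × B′ α ≡ 1ℚ)
  support⇒exactly-one α α∈S with entry-0-or-1 {ℰ = ℰ} block α | entry-0-or-1 {ℰ = ℰ} block′ α
  ... | inj₁ B≡0 | inj₁ B′≡0 =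
    contradiction (trans (sym α∈S) (trans (support≡B B′≡0) (cong isOne B≡0))) λ ()
  ... | inj₂ B≡1 | inj₁ B′≡0 = inj₁ (B≡1 , B′≡0)
  ... | inj₁ B≡0 | inj₂ B′≡1 = inj₂ (B≡0 , B′≡1)
  ... | inj₂ B≡1 | inj₂ B′≡1 =
    contradiction (one⇒Filled {ℰ = ℰ} block′ α B′≡1) (filled-disjoint tess α (one⇒Filled {ℰ = ℰ} block α B≡1))

0<1-p : ∀ {p} → p < 1ℚ → 0ℚ < 1ℚ - p
0<1-p {p} p<1 = subst (_< 1ℚ - p) (ℚ.+-inverseʳ p) (ℚ.+-monoˡ-< (- p) p<1)

convex-pos : ∀ {λ₀ x y} → 0ℚ < λ₀ → λ₀ < 1ℚ →
  (x ≡ 1ℚ × y ≡ 0ℚ) ⊎ (x ≡ 0ℚ × y ≡ 1ℚ) → 0ℚ < λ₀ * x + (1ℚ - λ₀) * y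
convex-pos {λ₀} 0<λ₀ _ (inj₁ (refl , refl)) = subst (0ℚ <_) (sym λ₀-only) 0<λ₀
  where
  λ₀-only : λ₀ * 1ℚ + (1ℚ - λ₀) * 0ℚ ≡ λ₀
  λ₀-only = trans (cong₂ _+_ (ℚ.*-identityʳ λ₀) (ℚ.*-zeroʳ (1ℚ - λ₀))) (ℚ.+-identityʳ λ₀)
convex-pos {λ₀} _ λ₀<1 (inj₂ (refl , refl)) = subst (0ℚ <_) (sym 1-λ₀-only) (0<1-p λ₀<1)
  where
  1-λ₀-only : λ₀ * 0ℚ + (1ℚ - λ₀) * 1ℚ ≡ 1ℚ - λ₀
  1-λ₀-only = trans (cong₂ _+_ (ℚ.*-zeroʳ λ₀) (ℚ.*-identityʳ (1ℚ - λ₀))) (ℚ.+-identityˡ (1ℚ - λ₀))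

*-nonNeg : ∀ {p q} → 0ℚ ≤ℚ p → 0ℚ ≤ℚ q → 0ℚ ≤ℚ p * q
*-nonNeg {p} {q} 0≤p 0≤q =
  ℚ.nonNegative⁻¹ (p * q) {{ℚ.nonNeg*nonNeg⇒nonNeg p {{nonNegative 0≤p}} q {{nonNegative 0≤q}}}}

*-pos : ∀ {p q} → 0ℚ < p → 0ℚ < q → 0ℚ < p * q
*-pos {p} {q} 0<p 0<q = ℚ.positive⁻¹ (p * q) {{ℚ.pos*pos⇒pos p {{positive 0<p}} q {{positive 0<q}}}}

0≤sumℚ : ∀ {xs} → All (0ℚ ≤ℚ_) xs → 0ℚ ≤ℚ sumℚ xs
0≤sumℚ []       = ℚ.≤-refl
0≤sumℚ (p ∷ ps) = ℚ.+-mono-≤ p (0≤sumℚ ps)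

0<sumℚ : ∀ {xs} → All (0ℚ ≤ℚ_) xs → Any (0ℚ <_) xs → 0ℚ < sumℚ xs
0<sumℚ (_ ∷ ps) (here 0<x)  = ℚ.+-mono-<-≤ 0<x (0≤sumℚ ps)
0<sumℚ (p ∷ ps) (there any) = ℚ.+-mono-≤-< p (0<sumℚ ps any)

All-concatMap⁺ : ∀ {A C : Set} {P : C → Set} {f : A → List C} →
  (∀ x → All P (f x)) → ∀ xs → All P (concatMap f xs)
All-concatMap⁺ h xs = All.concat⁺ (All.map⁺ (universal h xs))

∈-allIdx : ∀ {d} (α : Index d) → α ∈ allIdx d
∈-allIdx []      = here refl
∈-allIdx (a ∷ α) =
  ∈-concatMap⁺ (λ a → map (a ∷_) (allIdx _)) (lose (∈-allFin a) (∈-map⁺ (a ∷_) (∈-allIdx α)))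

permanent-pos : ∀ {d} {A : Matrix d} →
  (∀ α → 0ℚ ≤ℚ A α) → DiagonalIn (λ α → 0ℚ < A α) → 0ℚ < permanent A
permanent-pos {d} {A} A≥0 D = *-pos (ℚ.positive⁻¹ _) (0<sumℚ terms≥0 (lose term∈terms term>0))
  where
  open DiagonalIn D

  term : Index d → Index d → Index d → Index d → ℚ
  term α β γ δ = if isDiagonal α β γ δ then A α * A β * A γ * A δ else 0ℚ

  terms₃ : Index d → Index d → Index d → List ℚ
  terms₃ α β γ = map (term α β γ) (allIdx d)

  terms₂ : Index d → Index d → List ℚ
  terms₂ α β = concatMap (terms₃ α β) (allIdx d)

  terms₁ : Index d → List ℚ
  terms₁ α = concatMap (terms₂ α) (allIdx d)

  terms : List ℚ
  terms = concatMap terms₁ (allIdx d)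

  term≥0 : ∀ α β γ δ → 0ℚ ≤ℚ term α β γ δ
  term≥0 α β γ δ with isDiagonal α β γ δ
  ... | true  = *-nonNeg (*-nonNeg (*-nonNeg (A≥0 α) (A≥0 β)) (A≥0 γ)) (A≥0 δ)
  ... | false = ℚ.≤-refl

  terms≥0 : All (0ℚ ≤ℚ_) terms
  terms≥0 = All-concatMap⁺ (λ α → All-concatMap⁺ (λ β → All-concatMap⁺ (λ γ →
              All.map⁺ (universal (term≥0 α β γ) (allIdx d))) (allIdx d)) (allIdx d)) (allIdx d)

  term>0 : 0ℚ < term p₁ p₂ p₃ p₄
  term>0 rewrite diagonal = *-pos (*-pos (*-pos P-p₁ P-p₂) P-p₃) P-p₄

  term∈terms : term p₁ p₂ p₃ p₄ ∈ terms
  term∈terms =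
    ∈-concatMap⁺ terms₁ (lose (∈-allIdx p₁)
      (∈-concatMap⁺ (terms₂ p₁) (lose (∈-allIdx p₂)
        (∈-concatMap⁺ (terms₃ p₁ p₂) (lose (∈-allIdx p₃)
          (∈-map⁺ (term p₁ p₂ p₃) (∈-allIdx p₄)))))))

proposition8 :
    (d : ℕ) → 2 ≤ d →
    (A B B' : Matrix d) (λ₀ : ℚ) → 0ℚ < λ₀ → λ₀ < 1ℚ →
    Polystochastic A →
    EquivalentToM4 B → EquivalentToM4 B' →
    (∀ α → A α ≡ λ₀ * B α + (1ℚ - λ₀) * B' α) →
    (ℰ ℰ' : Vec Partition d) (s s' : Fin 2) →
    IsBlockPermutation B ℰ s → IsBlockPermutation B' ℰ' s' →
    TessellationIndexMinusInfinity ℰ s ℰ' s' →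
    0ℚ < permanent A
proposition8 (suc (suc _)) (s≤s (s≤s z≤n)) A B B′ λ₀ 0<λ₀ λ₀<1 (A≥0 , _) _ _ A≡ ℰ ℰ′ s s′ block block′ tess
  with same-partitions tess
... | refl = permanent-pos A≥0 (mapDiagonalIn A>0 (toggles⇒diagonal ℰ (support-toggles block block′ tess)))
  where
  A>0 : ∀ α → support B B′ α ≡ true → 0ℚ < A α
  A>0 α α∈S =
    subst (0ℚ <_) (sym (A≡ α)) (convex-pos 0<λ₀ λ₀<1 (support⇒exactly-one block block′ tess α α∈S))
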